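{- Let $\mathcal{T}$ be one of $\mathbf{CZF}$, $\mathbf{IZF}$, $\mathbf{ZF}$ (in the term language described in the context), and let $u$ be a fixed variable not occurring in the terms and formulas considered. For every term $a$ of $\mathcal{T}$ and every formula $\psi$ of $\mathcal{T}$: \begin{enumerate} \item $\mathcal{T}\vdash u=a\leftrightarrow D_{a}$; \item $\mathcal{T}\vdash \psi\leftrightarrow H_{\psi}$, \end{enumerate} where $D_a$ and $H_\psi$ are the formulas defined in the context.
   Context: The set theories are formulated in a language with terms and formulas. Terms: every variable; $\emptyset$ and $\omega$; $\{a,b\}$, $\bigcup a$, $\mathcal{P}(a)$ for terms $a,b$; and $\{x\in a\mid \varphi\}$ for a variable $x$, a term $a$ in which $x$ is not free and a formula $\varphi$ (this binds $x$). Formulas: $\bot$, $a=b$, $a\in b$, closed under $\wedge,\vee,\rightarrow,\forall x,\exists x$. $\Delta_0$-terms/formulas are defined analogously, with quantifiers only bounded ($\forall x(x\in a\rightarrow\varphi)$, $\exists x(x\in a\wedge\varphi)$, $a$ a $\Delta_0$-term not containing $x$ free) and comprehension only with $\Delta_0$-formulas. For $\mathbf{CZF}$ the term $\mathcal{P}(a)$ is absent and in $\{x\in a\mid\varphi\}$ the formula $\varphi$ must be $\Delta_0$. Only formulas in which no variable occurs both free and bound are considered. $\mathbf{IZF}$ has intuitionistic logic plus extensionality, the defining axioms $\neg(x\in\emptyset)$, $x\in\{y,z\}\leftrightarrow x=y\vee x=z$, $x\in\bigcup y\leftrightarrow\exists z(x\in z\wedge z\in y)$, $x\in\mathcal{P}(y)\leftrightarrow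 x\subseteq y$, $z\in\{x\in y\mid\varphi\}\leftrightarrow z\in y\wedge\varphi[z/x]$, the axiom characterizing $\omega$ as the least set containing $0$ and closed under $x\mapsto x\cup\{x\}$, collection, and $\in$-induction; $\mathbf{ZF}$ adds excluded middle; $\mathbf{CZF}$ has extensionality, the axioms for $\emptyset$, pairs, unions, $\omega$, $\in$-induction, $\Delta_0$-separation (for its comprehension terms), strong collection and subset collection. Definitions, by simultaneous recursion, of a formula $D_a$ for each term $a$ (free variables: those of $a$ together with $u$) and a formula $H_\psi$ for each formula $\psi$ (in both, $v,w$ denote fresh variables): $D_x:\equiv u=x$; $D_\emptyset:\equiv u=\emptyset$; $D_\omega:\equiv u=\omega$; $D_{\{a,b\}}:\equiv\exists v\exists w(D_a[v/u]\wedge D_b[w/u]\wedge u=\{v,w\})$; $D_{\bigcup a}:\equiv\exists v(D_a[v/u]\wedge u=\bigcup v)$; $D_{\mathcal{P}(a)}:\equiv\exists v(D_a[v/u]\wedge\forall w(w\in u\leftrightarrow w\subseteq v))$; $D_{\{x\in a\mid\varphi\}}:\equiv\exists v(D_a[v/u]\wedge\forall x(x\in u\leftrightarrow x\in v\wedge H_\varphi))$; $H_\bot:\equiv\bot$; $H_{a=b}:\equiv\exists u(D_a\wedge D_b\wedge u=u)$; $H_{a\in b}:\equiv\exists u\exists v(D_a\wedge D_b[v/u]\wedge u\in v)$; $H_{\varphi\,\kappa\,\psi}:\equiv H_\varphi\,\kappa\,H_\psi$ for $\kappa\in\{\wedge,\vee,\rightarrow\}$; $H_{\forall x\varphi}:\equiv\forall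 x(x=x\rightarrow H_\varphi)$; $H_{\exists x\varphi}:\equiv\exists x(x=x\wedge H_\varphi)$. -}

module Defs where

open import Data.Nat using (ℕ; suc; _⊔_)
open import Data.Nat.Properties using (_≟_)
open import Data.List using (List; []; _∷_; _++_; filter; foldr; concatMap)
open import Data.List.Membership.Propositional using (_∈_; _∉_)
open import Data.Bool using (if_then_else_)
open import Data.Product using (_×_)
open import Data.Unit using (⊤)
open import Data.Empty using (⊥)
open import Relation.Nullary using (¬_; does; ¬?)
open import Relation.Binary.PropositionalEquality using (_≡_; _≢_)

Var : Set
Var = ℕ

infix  7 _≐_ _∈f_
infixr 6 _∧f_
infixr 5 _∨f_
infixr 4 _⇒f_ _⇔f_

mutual
  data Term : Set where
    var   : Var → Term
    ∅t    : Term
    ωt    : Term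
    pairt : Term → Term → Term
    ⋃t    : Term → Term
    𝒫t    : Term → Term
    sept  : Var → Term → Formula → Term   -- { x ∈ a | φ }  (binds x in φ)

  data Formula : Set where
    ⊥f   : Formula
    _≐_  : Term → Term → Formula
    _∈f_ : Term → Term → Formula
    _∧f_ : Formula → Formula → Formula
    _∨f_ : Formula → Formula → Formula
    _⇒f_ : Formula → Formula → Formula
    ∀f   : Var → Formula → Formula
    ∃f   : Var → Formula → Formula

¬f_ : Formula → Formula
¬f φ = φ ⇒f ⊥f

_⇔f_ : Formula → Formula → Formula
φ ⇔f ψ = (φ ⇒f ψ) ∧f (ψ ⇒f φ)

removeVar : Var → List Var → List Var
removeVar x = filter (λ y → ¬? (y ≟ x))

mutual
  FVt : Term → List Var
  FVt (var x) = x ∷ []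
  FVt ∅t = []
  FVt ωt = []
  FVt (pairt a b) = FVt a ++ FVt b
  FVt (⋃t a) = FVt a
  FVt (𝒫t a) = FVt a
  FVt (sept x a φ) = FVt a ++ removeVar x (FVf φ)

  FVf : Formula → List Var
  FVf ⊥f = []
  FVf (a ≐ b) = FVt a ++ FVt b
  FVf (a ∈f b) = FVt a ++ FVt b
  FVf (φ ∧f ψ) = FVf φ ++ FVf ψ
  FVf (φ ∨f ψ) = FVf φ ++ FVf ψ
  FVf (φ ⇒f ψ) = FVf φ ++ FVf ψ
  FVf (∀f x φ) = removeVar x (FVf φ)
  FVf (∃f x φ) = removeVar x (FVf φ)

mutual
  BVt : Term → List Var
  BVt (var x) = []
  BVt ∅t = []
  BVt ωt = []
  BVt (pairt a b) = BVt a ++ BVt b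
  BVt (⋃t a) = BVt a
  BVt (𝒫t a) = BVt a
  BVt (sept x a φ) = x ∷ BVt a ++ BVf φ

  BVf : Formula → List Var
  BVf ⊥f = []
  BVf (a ≐ b) = BVt a ++ BVt b
  BVf (a ∈f b) = BVt a ++ BVt b
  BVf (φ ∧f ψ) = BVf φ ++ BVf ψ
  BVf (φ ∨f ψ) = BVf φ ++ BVf ψ
  BVf (φ ⇒f ψ) = BVf φ ++ BVf ψ
  BVf (∀f x φ) = x ∷ BVf φ
  BVf (∃f x φ) = x ∷ BVf φ

mutual
  varsT : Term → List Var
  varsT (var x) = x ∷ []
  varsT ∅t = []
  varsT ωt = []
  varsT (pairt a b) = varsT a ++ varsT b
  varsT (⋃t a) = varsT a
  varsT (𝒫t a) = varsT a
  varsT (sept x a φ) = x ∷ varsT a ++ varsF φ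

  varsF : Formula → List Var
  varsF ⊥f = []
  varsF (a ≐ b) = varsT a ++ varsT b
  varsF (a ∈f b) = varsT a ++ varsT b
  varsF (φ ∧f ψ) = varsF φ ++ varsF ψ
  varsF (φ ∨f ψ) = varsF φ ++ varsF ψ
  varsF (φ ⇒f ψ) = varsF φ ++ varsF ψ
  varsF (∀f x φ) = x ∷ varsF φ
  varsF (∃f x φ) = x ∷ varsF φ

CleanT : Term → Set
CleanT a = ∀ y → y ∈ FVt a → y ∈ BVt a → ⊥

CleanF : Formula → Set
CleanF φ = ∀ y → y ∈ FVf φ → y ∈ BVf φ → ⊥

FVs : List Formula → List Var
FVs = concatMap FVf

fresh : List Var → Var
fresh xs = suc (foldr _⊔_ 0 xs)

-- Substitution of a term s for the free occurrences of x (no renaming;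
-- used only together with the side condition FreeForF below).

mutual
  substT : Var → Term → Term → Term
  substT x s (var y) = if does (x ≟ y) then s else var y
  substT x s ∅t = ∅t
  substT x s ωt = ωt
  substT x s (pairt a b) = pairt (substT x s a) (substT x s b)
  substT x s (⋃t a) = ⋃t (substT x s a)
  substT x s (𝒫t a) = 𝒫t (substT x s a)
  substT x s (sept y a φ) =
    sept y (substT x s a) (if does (x ≟ y) then φ else substF x s φ)

  substF : Var → Term → Formula → Formula
  substF x s ⊥f = ⊥f
  substF x s (a ≐ b) = substT x s a ≐ substT x s b
  substF x s (a ∈f b) = substT x s a ∈f substT x s b
  substF x s (φ ∧f ψ) = substF x s φ ∧f substF x s ψ
  substF x s (φ ∨f ψ) = substF x s φ ∨f substF x s ψ
  substF x s (φ ⇒f ψ) = substF x s φ ⇒f substF x s ψ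
  substF x s (∀f y φ) = if does (x ≟ y) then ∀f y φ else ∀f y (substF x s φ)
  substF x s (∃f y φ) = if does (x ≟ y) then ∃f y φ else ∃f y (substF x s φ)

mutual
  FreeForT : Term → Var → Term → Set
  FreeForT s x (var y) = ⊤
  FreeForT s x ∅t = ⊤
  FreeForT s x ωt = ⊤
  FreeForT s x (pairt a b) = FreeForT s x a × FreeForT s x b
  FreeForT s x (⋃t a) = FreeForT s x a
  FreeForT s x (𝒫t a) = FreeForT s x a
  FreeForT s x (sept y a φ) =
    FreeForT s x a × (x ∈ removeVar y (FVf φ) → y ∉ FVt s × FreeForF s x φ)

  FreeForF : Term → Var → Formula → Set
  FreeForF s x ⊥f = ⊤
  FreeForF s x (a ≐ b) = FreeForT s x a × FreeForT s x b
  FreeForF s x (a ∈f b) = FreeForT s x a × FreeForT s x b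
  FreeForF s x (φ ∧f ψ) = FreeForF s x φ × FreeForF s x ψ
  FreeForF s x (φ ∨f ψ) = FreeForF s x φ × FreeForF s x ψ
  FreeForF s x (φ ⇒f ψ) = FreeForF s x φ × FreeForF s x ψ
  FreeForF s x (∀f y φ) = x ∈ removeVar y (FVf φ) → y ∉ FVt s × FreeForF s x φ
  FreeForF s x (∃f y φ) = x ∈ removeVar y (FVf φ) → y ∉ FVt s × FreeForF s x φ

mutual
  data Δ₀T : Term → Set where
    var   : ∀ x → Δ₀T (var x)
    ∅t    : Δ₀T ∅t
    ωt    : Δ₀T ωt
    pairt : ∀ {a b} → Δ₀T a → Δ₀T b → Δ₀T (pairt a b)
    ⋃t    : ∀ {a} → Δ₀T a → Δ₀T (⋃t a)
    𝒫t    : ∀ {a} → Δ₀T a → Δ₀T (𝒫t a)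
    sept  : ∀ {x a φ} → Δ₀T a → Δ₀F φ → Δ₀T (sept x a φ)

  data Δ₀F : Formula → Set where
    ⊥f   : Δ₀F ⊥f
    _≐_  : ∀ {a b} → Δ₀T a → Δ₀T b → Δ₀F (a ≐ b)
    _∈f_ : ∀ {a b} → Δ₀T a → Δ₀T b → Δ₀F (a ∈f b)
    _∧f_ : ∀ {φ ψ} → Δ₀F φ → Δ₀F ψ → Δ₀F (φ ∧f ψ)
    _∨f_ : ∀ {φ ψ} → Δ₀F φ → Δ₀F ψ → Δ₀F (φ ∨f ψ)
    _⇒f_ : ∀ {φ ψ} → Δ₀F φ → Δ₀F ψ → Δ₀F (φ ⇒f ψ)
    ball : ∀ {x a φ} → x ∉ FVt a → Δ₀T a → Δ₀F φ →
           Δ₀F (∀f x (var x ∈f a ⇒f φ))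
    bex  : ∀ {x a φ} → x ∉ FVt a → Δ₀T a → Δ₀F φ →
           Δ₀F (∃f x (var x ∈f a ∧f φ))

data Theory : Set where
  CZF IZF ZF : Theory

data Impredicative : Theory → Set where
  izf : Impredicative IZF
  zf  : Impredicative ZF

SepOK : Theory → Formula → Set
SepOK CZF φ = Δ₀F φ
SepOK IZF φ = ⊤
SepOK ZF φ = ⊤

mutual
  data LangT (T : Theory) : Term → Set where
    var   : ∀ x → LangT T (var x)
    ∅t    : LangT T ∅t
    ωt    : LangT T ωt
    pairt : ∀ {a b} → LangT T a → LangT T b → LangT T (pairt a b)
    ⋃t    : ∀ {a} → LangT T a → LangT T (⋃t a)
    𝒫t    : ∀ {a} → Impredicative T → LangT T a → LangT T (𝒫t a)
    sept  : ∀ {x a φ} → x ∉ FVt a → LangT T a → LangF T φ → SepOK T φ →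
            LangT T (sept x a φ)

  data LangF (T : Theory) : Formula → Set where
    ⊥f   : LangF T ⊥f
    _≐_  : ∀ {a b} → LangT T a → LangT T b → LangF T (a ≐ b)
    _∈f_ : ∀ {a b} → LangT T a → LangT T b → LangF T (a ∈f b)
    _∧f_ : ∀ {φ ψ} → LangF T φ → LangF T ψ → LangF T (φ ∧f ψ)
    _∨f_ : ∀ {φ ψ} → LangF T φ → LangF T ψ → LangF T (φ ∨f ψ)
    _⇒f_ : ∀ {φ ψ} → LangF T φ → LangF T ψ → LangF T (φ ⇒f ψ)
    ∀f   : ∀ {φ} x → LangF T φ → LangF T (∀f x φ)
    ∃f   : ∀ {φ} x → LangF T φ → LangF T (∃f x φ)

subsetF : Var → Term → Term → Formula
subsetF z a b = ∀f z (var z ∈f a ⇒f var z ∈f b)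

ballF : Var → Term → Formula → Formula
ballF x a φ = ∀f x (var x ∈f a ⇒f φ)

bexF : Var → Term → Formula → Formula
bexF x a φ = ∃f x (var x ∈f a ∧f φ)

-- successor  x ∪ {x}  =  ⋃ {x , {x , x}}
succT : Term → Term
succT a = ⋃t (pairt a (pairt a a))

Distinct : List Var → Set
Distinct [] = ⊤
Distinct (x ∷ xs) = x ∉ xs × Distinct xs

data Axiom : Theory → Formula → Set where
  extensionality : ∀ {T x y z} → Distinct (z ∷ x ∷ y ∷ []) →
    Axiom T (∀f z (var z ∈f var x ⇔f var z ∈f var y) ⇒f var x ≐ var y)
  emptyAx : ∀ {T x} → Axiom T (¬f (var x ∈f ∅t))
  pairAx : ∀ {T x y z} →
    Axiom T (var x ∈f pairt (var y) (var z) ⇔f (var x ≐ var y ∨f var x ≐ var z))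
  unionAx : ∀ {T x y z} → Distinct (z ∷ x ∷ y ∷ []) →
    Axiom T (var x ∈f ⋃t (var y) ⇔f ∃f z (var x ∈f var z ∧f var z ∈f var y))
  powerAx : ∀ {T x y z} → Impredicative T → Distinct (z ∷ x ∷ y ∷ []) →
    Axiom T (var x ∈f 𝒫t (var y) ⇔f subsetF z (var x) (var y))
  -- full separation for IZF/ZF, Δ₀-separation for CZF (via LangT)
  sepAx : ∀ {T x y z φ} → LangT T (sept x (var y) φ) → FreeForF (var z) x φ →
    Axiom T (var z ∈f sept x (var y) φ ⇔f
             (var z ∈f var y ∧f substF x (var z) φ))
  omegaAx : ∀ {T x y z} → Distinct (x ∷ y ∷ z ∷ []) →
    Axiom T ((∅t ∈f ωt)
         ∧f ballF x ωt (succT (var x) ∈f ωt)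
         ∧f ∀f y ((∅t ∈f var y ∧f ballF x (var y) (succT (var x) ∈f var y))
                  ⇒f subsetF z ωt (var y)))
  collection : ∀ {T a b x y φ} → Impredicative T → LangF T φ →
    Distinct (a ∷ b ∷ x ∷ y ∷ []) → b ∉ FVf φ →
    Axiom T (ballF x (var a) (∃f y φ) ⇒f
             ∃f b (ballF x (var a) (bexF y (var b) φ)))
  ∈-induction : ∀ {T x y φ} → LangF T φ → y ≢ x → y ∉ FVf φ →
    FreeForF (var y) x φ →
    Axiom T (∀f x (ballF y (var x) (substF x (var y) φ) ⇒f φ) ⇒f ∀f x φ)
  strongCollection : ∀ {a b x y φ} → LangF CZF φ →
    Distinct (a ∷ b ∷ x ∷ y ∷ []) → b ∉ FVf φ →
    Axiom CZF (ballF x (var a) (∃f y φ) ⇒f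
               ∃f b (ballF x (var a) (bexF y (var b) φ)
                     ∧f ballF y (var b) (bexF x (var a) φ)))
  subsetCollection : ∀ {a b c d p x y φ} → LangF CZF φ →
    Distinct (a ∷ b ∷ c ∷ d ∷ p ∷ x ∷ y ∷ []) → c ∉ FVf φ → d ∉ FVf φ →
    Axiom CZF (∃f c (∀f p (ballF x (var a) (bexF y (var b) φ) ⇒f
               bexF d (var c) (ballF x (var a) (bexF y (var d) φ)
                               ∧f ballF y (var d) (bexF x (var a) φ)))))
  excludedMiddle : ∀ {φ} → LangF ZF φ → Axiom ZF (φ ∨f ¬f φ)

-- Intuitionistic natural deduction with equality over the theory T.
-- Every formula/term introduced by a rule must belong to T's language.

data Prf (T : Theory) (Γ : List Formula) : Formula → Set where
  axiom : ∀ {φ} → Axiom T φ → Prf T Γ φ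
  hyp   : ∀ {φ} → φ ∈ Γ → Prf T Γ φ
  ∧I    : ∀ {φ ψ} → Prf T Γ φ → Prf T Γ ψ → Prf T Γ (φ ∧f ψ)
  ∧E₁   : ∀ {φ ψ} → Prf T Γ (φ ∧f ψ) → Prf T Γ φ
  ∧E₂   : ∀ {φ ψ} → Prf T Γ (φ ∧f ψ) → Prf T Γ ψ
  ∨I₁   : ∀ {φ ψ} → LangF T ψ → Prf T Γ φ → Prf T Γ (φ ∨f ψ)
  ∨I₂   : ∀ {φ ψ} → LangF T φ → Prf T Γ ψ → Prf T Γ (φ ∨f ψ)
  ∨E    : ∀ {φ ψ χ} → Prf T Γ (φ ∨f ψ) → Prf T (φ ∷ Γ) χ → Prf T (ψ ∷ Γ) χ →
          Prf T Γ χ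
  ⇒I    : ∀ {φ ψ} → LangF T φ → Prf T (φ ∷ Γ) ψ → Prf T Γ (φ ⇒f ψ)
  ⇒E    : ∀ {φ ψ} → Prf T Γ (φ ⇒f ψ) → Prf T Γ φ → Prf T Γ ψ
  ⊥E    : ∀ {φ} → LangF T φ → Prf T Γ ⊥f → Prf T Γ φ
  ∀I    : ∀ {x φ} → x ∉ FVs Γ → Prf T Γ φ → Prf T Γ (∀f x φ)
  ∀E    : ∀ {x φ} t → LangT T t → FreeForF t x φ → Prf T Γ (∀f x φ) →
          Prf T Γ (substF x t φ)
  ∃I    : ∀ {x φ} t → LangF T (∃f x φ) → LangT T t → FreeForF t x φ →
          Prf T Γ (substF x t φ) → Prf T Γ (∃f x φ)
  ∃E    : ∀ {x φ χ} → Prf T Γ (∃f x φ) → x ∉ FVs Γ → x ∉ FVf χ →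
          Prf T (φ ∷ Γ) χ → Prf T Γ χ
  refl≐ : ∀ {t} → LangT T t → Prf T Γ (t ≐ t)
  leibniz : ∀ {s t x φ} → LangF T φ → FreeForF s x φ → FreeForF t x φ →
          Prf T Γ (s ≐ t) → Prf T Γ (substF x s φ) → Prf T Γ (substF x t φ)

_⊢_ : Theory → Formula → Set
T ⊢ φ = Prf T [] φ

-- D u a t is D_a[t/u]  (D u a u is D_a); H u ψ is H_ψ.
-- u is the fixed variable (also used as the bound variable in H at atoms);
-- fresh variables are chosen canonically by `fresh`.

mutual
  D : Var → Term → Var → Formula
  D u (var x) t = var t ≐ var x
  D u ∅t t = var t ≐ ∅t
  D u ωt t = var t ≐ ωt
  D u (pairt a b) t =
      ∃f v (∃f w (D u a v ∧f D u b w ∧f var t ≐ pairt (var v) (var w)))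
    where v = fresh (u ∷ t ∷ varsT a ++ varsT b)
          w = suc v
  D u (⋃t a) t = ∃f v (D u a v ∧f var t ≐ ⋃t (var v))
    where v = fresh (u ∷ t ∷ varsT a)
  D u (𝒫t a) t =
      ∃f v (D u a v ∧f ∀f w (var w ∈f var t ⇔f subsetF z (var w) (var v)))
    where v = fresh (u ∷ t ∷ varsT a)
          w = suc v
          z = suc w
  D u (sept x a φ) t =
      ∃f v (D u a v ∧f ∀f x (var x ∈f var t ⇔f (var x ∈f var v ∧f H u φ)))
    where v = fresh (u ∷ t ∷ x ∷ varsT a ++ varsF φ)

  H : Var → Formula → Formula
  H u ⊥f = ⊥f
  H u (a ≐ b) = ∃f u (D u a u ∧f D u b u ∧f var u ≐ var u)
  H u (a ∈f b) = ∃f u (∃f v (D u a u ∧f D u b v ∧f var u ∈f var v))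
    where v = fresh (u ∷ varsT a ++ varsT b)
  H u (φ ∧f ψ) = H u φ ∧f H u ψ
  H u (φ ∨f ψ) = H u φ ∨f H u ψ
  H u (φ ⇒f ψ) = H u φ ⇒f H u ψ
  H u (∀f x φ) = ∀f x (var x ≐ var x ⇒f H u φ)
  H u (∃f x φ) = ∃f x (var x ≐ var x ∧f H u φ)

module Submission where

-- By simultaneous induction on terms and formulas, the term clause being
-- generalised to  t = a ↔ D_a[t/u]  for every variable t not occurring in a.
-- For a compound term f(a) the inductive hypothesis says that D_a[v/u] defines
-- a, so the one-point rule gives  t = f(a) ↔ ∃v (D_a[v/u] ∧ t = f(v)).  For
-- power sets and separation, D_{f(a)} describes t = f(v) by its members instead,
-- which is equivalent by extensionality and the power set or separation axiom.
-- The atomic cases of H are again one-point rules, connectives are handled by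
-- congruence, and the guards x = x added at quantifiers are provable.

open import Data.Empty using (⊥-elim)
open import Data.List using (List; []; _∷_; _++_; foldr)
open import Data.List.Membership.Propositional using (_∈_; _∉_)
open import Data.List.Membership.Propositional.Properties
  using (∈-++⁺ˡ; ∈-++⁺ʳ; ∈-++⁻; ∈-filter⁻; ∈-filter⁺)
open import Data.List.Relation.Unary.All using (All; []; _∷_)
open import Data.List.Relation.Unary.Any using (here; there)
open import Data.Nat using (suc; _⊔_; _≤_; s≤s)
open import Data.Nat.Properties
  using (_≟_; m≤m⊔n; m≤n⊔m; ≤-trans; ≤-refl; n≤1+n; <⇒≢; 1+n≢n; m+1+n≢n)
open import Data.Product using (_×_; _,_; proj₁; proj₂)
open import Data.Sum using (_⊎_; inj₁; inj₂)
open import Data.Unit using (tt)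
open import Relation.Nullary using (yes; no; ¬?)
open import Relation.Nullary.Decidable using (dec-true; dec-false)
open import Relation.Binary.PropositionalEquality
  using (_≡_; _≢_; refl; sym; trans; cong; cong₂; subst)

open import Defs

∉-++⁺ : ∀ {x : Var} {xs ys} → x ∉ xs → x ∉ ys → x ∉ xs ++ ys
∉-++⁺ {xs = xs} x∉xs x∉ys x∈ with ∈-++⁻ xs x∈
... | inj₁ x∈xs = x∉xs x∈xs
... | inj₂ x∈ys = x∉ys x∈ys

∉-++⁻ˡ : ∀ {x : Var} {xs} ys → x ∉ xs ++ ys → x ∉ xs
∉-++⁻ˡ _ x∉ x∈ = x∉ (∈-++⁺ˡ x∈)

∉-++⁻ʳ : ∀ {x : Var} xs {ys} → x ∉ xs ++ ys → x ∉ ys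
∉-++⁻ʳ xs x∉ x∈ = x∉ (∈-++⁺ʳ xs x∈)

∈-removeVar⁻ : ∀ x l {y} → y ∈ removeVar x l → y ∈ l × y ≢ x
∈-removeVar⁻ x l = ∈-filter⁻ (λ z → ¬? (z ≟ x)) {xs = l}

∈-removeVar⁺ : ∀ x l {y} → y ∈ l → y ≢ x → y ∈ removeVar x l
∈-removeVar⁺ x l = ∈-filter⁺ (λ z → ¬? (z ≟ x))

∉-removeVar⁺ : ∀ x l {y} → y ∉ l → y ∉ removeVar x l
∉-removeVar⁺ x l y∉ y∈ = y∉ (proj₁ (∈-removeVar⁻ x l y∈))

∉-removeVar : ∀ x l → x ∉ removeVar x l
∉-removeVar x l x∈ = proj₂ (∈-removeVar⁻ x l x∈) refl

≤-foldr-⊔ : ∀ {y} xs → y ∈ xs → y ≤ foldr _⊔_ 0 xs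
≤-foldr-⊔ (x ∷ xs) (here refl) = m≤m⊔n x _
≤-foldr-⊔ (x ∷ xs) (there y∈) = ≤-trans (≤-foldr-⊔ xs y∈) (m≤n⊔m x _)

fresh≤⇒∉ : ∀ {n} xs → fresh xs ≤ n → n ∉ xs
fresh≤⇒∉ xs le n∈ = <⇒≢ (≤-trans (s≤s (≤-foldr-⊔ xs n∈)) le) refl

fresh-∉ : ∀ xs → fresh xs ∉ xs
fresh-∉ xs = fresh≤⇒∉ xs ≤-refl

fresh+1-∉ : ∀ xs → suc (fresh xs) ∉ xs
fresh+1-∉ xs = fresh≤⇒∉ xs (n≤1+n _)

substT-var-self : ∀ x s → substT x s (var x) ≡ s
substT-var-self x s rewrite dec-true (x ≟ x) refl = refl

substT-var-other : ∀ {x y} s → x ≢ y → substT x s (var y) ≡ var y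
substT-var-other {x} {y} s x≢y rewrite dec-false (x ≟ y) x≢y = refl

mutual
  substT-absent : ∀ x s a → x ∉ varsT a → substT x s a ≡ a
  substT-absent x s (var y) x∉ = substT-var-other s (λ e → x∉ (here e))
  substT-absent x s ∅t x∉ = refl
  substT-absent x s ωt x∉ = refl
  substT-absent x s (pairt a b) x∉ =
    cong₂ pairt (substT-absent x s a (∉-++⁻ˡ (varsT b) x∉))
                (substT-absent x s b (∉-++⁻ʳ (varsT a) x∉))
  substT-absent x s (⋃t a) x∉ = cong ⋃t (substT-absent x s a x∉)
  substT-absent x s (𝒫t a) x∉ = cong 𝒫t (substT-absent x s a x∉)
  substT-absent x s (sept y a φ) x∉ with x ≟ y
  ... | yes x≡y = ⊥-elim (x∉ (here x≡y))
  ... | no x≢y rewrite dec-false (x ≟ y) x≢y =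
    cong₂ (sept y) (substT-absent x s a (∉-++⁻ˡ (varsF φ) (λ m → x∉ (there m))))
                   (substF-absent x s φ (∉-++⁻ʳ (varsT a) (λ m → x∉ (there m))))

  substF-absent : ∀ x s φ → x ∉ varsF φ → substF x s φ ≡ φ
  substF-absent x s ⊥f x∉ = refl
  substF-absent x s (a ≐ b) x∉ =
    cong₂ _≐_ (substT-absent x s a (∉-++⁻ˡ (varsT b) x∉))
              (substT-absent x s b (∉-++⁻ʳ (varsT a) x∉))
  substF-absent x s (a ∈f b) x∉ =
    cong₂ _∈f_ (substT-absent x s a (∉-++⁻ˡ (varsT b) x∉))
               (substT-absent x s b (∉-++⁻ʳ (varsT a) x∉))
  substF-absent x s (φ ∧f ψ) x∉ =
    cong₂ _∧f_ (substF-absent x s φ (∉-++⁻ˡ (varsF ψ) x∉))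
               (substF-absent x s ψ (∉-++⁻ʳ (varsF φ) x∉))
  substF-absent x s (φ ∨f ψ) x∉ =
    cong₂ _∨f_ (substF-absent x s φ (∉-++⁻ˡ (varsF ψ) x∉))
               (substF-absent x s ψ (∉-++⁻ʳ (varsF φ) x∉))
  substF-absent x s (φ ⇒f ψ) x∉ =
    cong₂ _⇒f_ (substF-absent x s φ (∉-++⁻ˡ (varsF ψ) x∉))
               (substF-absent x s ψ (∉-++⁻ʳ (varsF φ) x∉))
  substF-absent x s (∀f y φ) x∉ with x ≟ y
  ... | yes x≡y rewrite dec-true (x ≟ y) x≡y = refl
  ... | no x≢y rewrite dec-false (x ≟ y) x≢y = cong (∀f y) (substF-absent x s φ (λ m → x∉ (there m)))
  substF-absent x s (∃f y φ) x∉ with x ≟ y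
  ... | yes x≡y rewrite dec-true (x ≟ y) x≡y = refl
  ... | no x≢y rewrite dec-false (x ≟ y) x≢y = cong (∃f y) (substF-absent x s φ (λ m → x∉ (there m)))

mutual
  substT-id : ∀ x a → substT x (var x) a ≡ a
  substT-id x (var y) with x ≟ y
  ... | yes x≡y rewrite dec-true (x ≟ y) x≡y = cong var x≡y
  ... | no x≢y rewrite dec-false (x ≟ y) x≢y = refl
  substT-id x ∅t = refl
  substT-id x ωt = refl
  substT-id x (pairt a b) = cong₂ pairt (substT-id x a) (substT-id x b)
  substT-id x (⋃t a) = cong ⋃t (substT-id x a)
  substT-id x (𝒫t a) = cong 𝒫t (substT-id x a)
  substT-id x (sept y a φ) with x ≟ y
  ... | yes x≡y rewrite dec-true (x ≟ y) x≡y = cong₂ (sept y) (substT-id x a) refl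
  ... | no x≢y rewrite dec-false (x ≟ y) x≢y = cong₂ (sept y) (substT-id x a) (substF-id x φ)

  substF-id : ∀ x φ → substF x (var x) φ ≡ φ
  substF-id x ⊥f = refl
  substF-id x (a ≐ b) = cong₂ _≐_ (substT-id x a) (substT-id x b)
  substF-id x (a ∈f b) = cong₂ _∈f_ (substT-id x a) (substT-id x b)
  substF-id x (φ ∧f ψ) = cong₂ _∧f_ (substF-id x φ) (substF-id x ψ)
  substF-id x (φ ∨f ψ) = cong₂ _∨f_ (substF-id x φ) (substF-id x ψ)
  substF-id x (φ ⇒f ψ) = cong₂ _⇒f_ (substF-id x φ) (substF-id x ψ)
  substF-id x (∀f y φ) with x ≟ y
  ... | yes x≡y rewrite dec-true (x ≟ y) x≡y = refl
  ... | no x≢y rewrite dec-false (x ≟ y) x≢y = cong (∀f y) (substF-id x φ)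
  substF-id x (∃f y φ) with x ≟ y
  ... | yes x≡y rewrite dec-true (x ≟ y) x≡y = refl
  ... | no x≢y rewrite dec-false (x ≟ y) x≢y = cong (∃f y) (substF-id x φ)

substT-sept : ∀ {v x} s b φ → v ≢ x → v ∉ varsF φ →
              substT v s (sept x b φ) ≡ sept x (substT v s b) φ
substT-sept {v} {x} s b φ v≢x v∉φ rewrite dec-false (v ≟ x) v≢x =
  cong (sept x (substT v s b)) (substF-absent v s φ v∉φ)

substF-∀ : ∀ {x y} s φ → x ≢ y → substF x s (∀f y φ) ≡ ∀f y (substF x s φ)
substF-∀ {x} {y} s φ x≢y rewrite dec-false (x ≟ y) x≢y = refl

mutual
  FreeForT-notFree : ∀ s x a → x ∉ FVt a → FreeForT s x a
  FreeForT-notFree s x (var y) _ = tt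
  FreeForT-notFree s x ∅t _ = tt
  FreeForT-notFree s x ωt _ = tt
  FreeForT-notFree s x (pairt a b) x∉ =
    FreeForT-notFree s x a (∉-++⁻ˡ (FVt b) x∉) , FreeForT-notFree s x b (∉-++⁻ʳ (FVt a) x∉)
  FreeForT-notFree s x (⋃t a) x∉ = FreeForT-notFree s x a x∉
  FreeForT-notFree s x (𝒫t a) x∉ = FreeForT-notFree s x a x∉
  FreeForT-notFree s x (sept y a φ) x∉ =
    FreeForT-notFree s x a (∉-++⁻ˡ _ x∉) , λ m → ⊥-elim (∉-++⁻ʳ (FVt a) x∉ m)

  FreeForF-notFree : ∀ s x φ → x ∉ FVf φ → FreeForF s x φ
  FreeForF-notFree s x ⊥f _ = tt
  FreeForF-notFree s x (a ≐ b) x∉ =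
    FreeForT-notFree s x a (∉-++⁻ˡ (FVt b) x∉) , FreeForT-notFree s x b (∉-++⁻ʳ (FVt a) x∉)
  FreeForF-notFree s x (a ∈f b) x∉ =
    FreeForT-notFree s x a (∉-++⁻ˡ (FVt b) x∉) , FreeForT-notFree s x b (∉-++⁻ʳ (FVt a) x∉)
  FreeForF-notFree s x (φ ∧f ψ) x∉ =
    FreeForF-notFree s x φ (∉-++⁻ˡ (FVf ψ) x∉) , FreeForF-notFree s x ψ (∉-++⁻ʳ (FVf φ) x∉)
  FreeForF-notFree s x (φ ∨f ψ) x∉ =
    FreeForF-notFree s x φ (∉-++⁻ˡ (FVf ψ) x∉) , FreeForF-notFree s x ψ (∉-++⁻ʳ (FVf φ) x∉)
  FreeForF-notFree s x (φ ⇒f ψ) x∉ =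
    FreeForF-notFree s x φ (∉-++⁻ˡ (FVf ψ) x∉) , FreeForF-notFree s x ψ (∉-++⁻ʳ (FVf φ) x∉)
  FreeForF-notFree s x (∀f y φ) x∉ = λ m → ⊥-elim (x∉ m)
  FreeForF-notFree s x (∃f y φ) x∉ = λ m → ⊥-elim (x∉ m)

binder-∉-self : ∀ {x} y l → x ∈ removeVar y l → y ∉ FVt (var x)
binder-∉-self y l x∈ (here y≡x) = proj₂ (∈-removeVar⁻ y l x∈) (sym y≡x)

mutual
  FreeForT-self : ∀ x a → FreeForT (var x) x a
  FreeForT-self x (var y) = tt
  FreeForT-self x ∅t = tt
  FreeForT-self x ωt = tt
  FreeForT-self x (pairt a b) = FreeForT-self x a , FreeForT-self x b
  FreeForT-self x (⋃t a) = FreeForT-self x a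
  FreeForT-self x (𝒫t a) = FreeForT-self x a
  FreeForT-self x (sept y a φ) = FreeForT-self x a , λ m → binder-∉-self y (FVf φ) m , FreeForF-self x φ

  FreeForF-self : ∀ x φ → FreeForF (var x) x φ
  FreeForF-self x ⊥f = tt
  FreeForF-self x (a ≐ b) = FreeForT-self x a , FreeForT-self x b
  FreeForF-self x (a ∈f b) = FreeForT-self x a , FreeForT-self x b
  FreeForF-self x (φ ∧f ψ) = FreeForF-self x φ , FreeForF-self x ψ
  FreeForF-self x (φ ∨f ψ) = FreeForF-self x φ , FreeForF-self x ψ
  FreeForF-self x (φ ⇒f ψ) = FreeForF-self x φ , FreeForF-self x ψ
  FreeForF-self x (∀f y φ) = λ m → binder-∉-self y (FVf φ) m , FreeForF-self x φ
  FreeForF-self x (∃f y φ) = λ m → binder-∉-self y (FVf φ) m , FreeForF-self x φ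

mutual
  FVt⊆varsT : ∀ a {y} → y ∈ FVt a → y ∈ varsT a
  FVt⊆varsT (var x) y∈ = y∈
  FVt⊆varsT (pairt a b) y∈ with ∈-++⁻ (FVt a) y∈
  ... | inj₁ p = ∈-++⁺ˡ (FVt⊆varsT a p)
  ... | inj₂ p = ∈-++⁺ʳ (varsT a) (FVt⊆varsT b p)
  FVt⊆varsT (⋃t a) y∈ = FVt⊆varsT a y∈
  FVt⊆varsT (𝒫t a) y∈ = FVt⊆varsT a y∈
  FVt⊆varsT (sept x a φ) y∈ with ∈-++⁻ (FVt a) y∈
  ... | inj₁ p = there (∈-++⁺ˡ (FVt⊆varsT a p))
  ... | inj₂ p = there (∈-++⁺ʳ (varsT a) (FVf⊆varsF φ (proj₁ (∈-removeVar⁻ x (FVf φ) p))))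

  FVf⊆varsF : ∀ φ {y} → y ∈ FVf φ → y ∈ varsF φ
  FVf⊆varsF (a ≐ b) y∈ with ∈-++⁻ (FVt a) y∈
  ... | inj₁ p = ∈-++⁺ˡ (FVt⊆varsT a p)
  ... | inj₂ p = ∈-++⁺ʳ (varsT a) (FVt⊆varsT b p)
  FVf⊆varsF (a ∈f b) y∈ with ∈-++⁻ (FVt a) y∈
  ... | inj₁ p = ∈-++⁺ˡ (FVt⊆varsT a p)
  ... | inj₂ p = ∈-++⁺ʳ (varsT a) (FVt⊆varsT b p)
  FVf⊆varsF (φ ∧f ψ) y∈ = FVf⊆varsF-++ φ ψ y∈
  FVf⊆varsF (φ ∨f ψ) y∈ = FVf⊆varsF-++ φ ψ y∈
  FVf⊆varsF (φ ⇒f ψ) y∈ = FVf⊆varsF-++ φ ψ y∈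
  FVf⊆varsF (∀f x φ) y∈ = there (FVf⊆varsF φ (proj₁ (∈-removeVar⁻ x (FVf φ) y∈)))
  FVf⊆varsF (∃f x φ) y∈ = there (FVf⊆varsF φ (proj₁ (∈-removeVar⁻ x (FVf φ) y∈)))

  FVf⊆varsF-++ : ∀ φ ψ {y} → y ∈ FVf φ ++ FVf ψ → y ∈ varsF φ ++ varsF ψ
  FVf⊆varsF-++ φ ψ y∈ with ∈-++⁻ (FVf φ) y∈
  ... | inj₁ p = ∈-++⁺ˡ (FVf⊆varsF φ p)
  ... | inj₂ p = ∈-++⁺ʳ (varsF φ) (FVf⊆varsF ψ p)

∉varsT⇒∉FVt : ∀ {x} a → x ∉ varsT a → x ∉ FVt a
∉varsT⇒∉FVt a x∉ x∈ = x∉ (FVt⊆varsT a x∈)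

∉varsF⇒∉FVf : ∀ {x} φ → x ∉ varsF φ → x ∉ FVf φ
∉varsF⇒∉FVf φ x∉ x∈ = x∉ (FVf⊆varsF φ x∈)

FV-⇔ : ∀ φ ψ {y} → y ∈ FVf (φ ⇔f ψ) → y ∈ FVf φ ⊎ y ∈ FVf ψ
FV-⇔ φ ψ y∈ with ∈-++⁻ (FVf φ ++ FVf ψ) y∈
... | inj₁ p = ∈-++⁻ (FVf φ) p
... | inj₂ p with ∈-++⁻ (FVf ψ) p
...   | inj₁ q = inj₂ q
...   | inj₂ q = inj₁ q

∉-FV-⇔ : ∀ φ ψ {y} → y ∉ FVf φ → y ∉ FVf ψ → y ∉ FVf (φ ⇔f ψ)
∉-FV-⇔ φ ψ y∉φ y∉ψ y∈ with FV-⇔ φ ψ y∈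
... | inj₁ p = y∉φ p
... | inj₂ p = y∉ψ p

FV-subsetF : ∀ z w v {y} → y ∈ FVf (subsetF z (var w) (var v)) → y ≡ w ⊎ y ≡ v
FV-subsetF z w v y∈ with ∈-removeVar⁻ z (z ∷ w ∷ z ∷ v ∷ []) y∈
... | here y≡z , y≢z = ⊥-elim (y≢z y≡z)
... | there (here y≡w) , _ = inj₁ y≡w
... | there (there (here y≡z)) , y≢z = ⊥-elim (y≢z y≡z)
... | there (there (there (here y≡v))) , _ = inj₂ y≡v

mutual
  FV-D : ∀ u a t {y} → y ∈ FVf (D u a t) → y ≡ t ⊎ y ∈ FVt a
  FV-D u (var x) t (here y≡t) = inj₁ y≡t
  FV-D u (var x) t (there (here y≡x)) = inj₂ (here y≡x)
  FV-D u ∅t t (here y≡t) = inj₁ y≡t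
  FV-D u ωt t (here y≡t) = inj₁ y≡t
  FV-D u (pairt a b) t {y} y∈ = go (∈-removeVar⁻ v _ y∈)
    where
      v = fresh (u ∷ t ∷ varsT a ++ varsT b)
      w = suc v
      go : y ∈ removeVar w (FVf (D u a v) ++ FVf (D u b w) ++ t ∷ v ∷ w ∷ []) × y ≢ v →
           y ≡ t ⊎ y ∈ FVt a ++ FVt b
      go (y∈′ , y≢v) with ∈-removeVar⁻ w _ y∈′
      ... | p , y≢w with ∈-++⁻ (FVf (D u a v)) p
      ... | inj₁ q = inj₂ (∈-++⁺ˡ (FV-D-≢ u a y≢v q))
      ... | inj₂ q with ∈-++⁻ (FVf (D u b w)) q
      ... | inj₁ r = inj₂ (∈-++⁺ʳ (FVt a) (FV-D-≢ u b y≢w r))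
      ... | inj₂ (here y≡t) = inj₁ y≡t
      ... | inj₂ (there (here y≡v)) = ⊥-elim (y≢v y≡v)
      ... | inj₂ (there (there (here y≡w))) = ⊥-elim (y≢w y≡w)
  FV-D u (⋃t a) t {y} y∈ = go (∈-removeVar⁻ v _ y∈)
    where
      v = fresh (u ∷ t ∷ varsT a)
      go : y ∈ FVf (D u a v) ++ t ∷ v ∷ [] × y ≢ v → y ≡ t ⊎ y ∈ FVt a
      go (p , y≢v) with ∈-++⁻ (FVf (D u a v)) p
      ... | inj₁ q = inj₂ (FV-D-≢ u a y≢v q)
      ... | inj₂ (here y≡t) = inj₁ y≡t
      ... | inj₂ (there (here y≡v)) = ⊥-elim (y≢v y≡v)
  FV-D u (𝒫t a) t {y} y∈ = go (∈-removeVar⁻ v _ y∈)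
    where
      v = fresh (u ∷ t ∷ varsT a)
      w = suc v
      z = suc w
      Sub = subsetF z (var w) (var v)
      go : y ∈ FVf (D u a v) ++ removeVar w (FVf (var w ∈f var t ⇔f Sub)) × y ≢ v →
           y ≡ t ⊎ y ∈ FVt a
      go (p , y≢v) with ∈-++⁻ (FVf (D u a v)) p
      ... | inj₁ q = inj₂ (FV-D-≢ u a y≢v q)
      ... | inj₂ q with ∈-removeVar⁻ w _ q
      ... | r , y≢w with FV-⇔ (var w ∈f var t) Sub r
      ... | inj₁ (here y≡w) = ⊥-elim (y≢w y≡w)
      ... | inj₁ (there (here y≡t)) = inj₁ y≡t
      ... | inj₂ s with FV-subsetF z w v s
      ... | inj₁ y≡w = ⊥-elim (y≢w y≡w)
      ... | inj₂ y≡v = ⊥-elim (y≢v y≡v)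
  FV-D u (sept x a φ) t {y} y∈ = go (∈-removeVar⁻ v _ y∈)
    where
      v = fresh (u ∷ t ∷ x ∷ varsT a ++ varsF φ)
      Body = var x ∈f var v ∧f H u φ
      go : y ∈ FVf (D u a v) ++ removeVar x (FVf (var x ∈f var t ⇔f Body)) × y ≢ v →
           y ≡ t ⊎ y ∈ FVt (sept x a φ)
      go (p , y≢v) with ∈-++⁻ (FVf (D u a v)) p
      ... | inj₁ q = inj₂ (∈-++⁺ˡ (FV-D-≢ u a y≢v q))
      ... | inj₂ q with ∈-removeVar⁻ x _ q
      ... | r , y≢x with FV-⇔ (var x ∈f var t) Body r
      ... | inj₁ (here y≡x) = ⊥-elim (y≢x y≡x)
      ... | inj₁ (there (here y≡t)) = inj₁ y≡t
      ... | inj₂ (here y≡x) = ⊥-elim (y≢x y≡x)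
      ... | inj₂ (there (here y≡v)) = ⊥-elim (y≢v y≡v)
      ... | inj₂ (there (there s)) =
        inj₂ (∈-++⁺ʳ (FVt a) (∈-removeVar⁺ x (FVf φ) (FV-H u φ s) y≢x))

  FV-D-≢ : ∀ u a {t y} → y ≢ t → y ∈ FVf (D u a t) → y ∈ FVt a
  FV-D-≢ u a {t} y≢t y∈ with FV-D u a t y∈
  ... | inj₁ y≡t = ⊥-elim (y≢t y≡t)
  ... | inj₂ p = p

  FV-H : ∀ u ψ {y} → y ∈ FVf (H u ψ) → y ∈ FVf ψ
  FV-H u (a ≐ b) y∈ with ∈-removeVar⁻ u _ y∈
  ... | p , y≢u with ∈-++⁻ (FVf (D u a u)) p
  ... | inj₁ q = ∈-++⁺ˡ (FV-D-≢ u a y≢u q)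
  ... | inj₂ q with ∈-++⁻ (FVf (D u b u)) q
  ... | inj₁ r = ∈-++⁺ʳ (FVt a) (FV-D-≢ u b y≢u r)
  ... | inj₂ (here y≡u) = ⊥-elim (y≢u y≡u)
  ... | inj₂ (there (here y≡u)) = ⊥-elim (y≢u y≡u)
  FV-H u (a ∈f b) y∈ with ∈-removeVar⁻ u _ y∈
  ... | p , y≢u with ∈-removeVar⁻ (fresh (u ∷ varsT a ++ varsT b)) _ p
  ... | p′ , y≢v with ∈-++⁻ (FVf (D u a u)) p′
  ... | inj₁ q = ∈-++⁺ˡ (FV-D-≢ u a y≢u q)
  ... | inj₂ q with ∈-++⁻ (FVf (D u b (fresh (u ∷ varsT a ++ varsT b)))) q
  ... | inj₁ r = ∈-++⁺ʳ (FVt a) (FV-D-≢ u b y≢v r)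
  ... | inj₂ (here y≡u) = ⊥-elim (y≢u y≡u)
  ... | inj₂ (there (here y≡v)) = ⊥-elim (y≢v y≡v)
  FV-H u (φ ∧f ψ) y∈ = FV-H-++ u φ ψ y∈
  FV-H u (φ ∨f ψ) y∈ = FV-H-++ u φ ψ y∈
  FV-H u (φ ⇒f ψ) y∈ = FV-H-++ u φ ψ y∈
  FV-H u (∀f x φ) y∈ = FV-H-relativized u x φ y∈
  FV-H u (∃f x φ) y∈ = FV-H-relativized u x φ y∈

  FV-H-++ : ∀ u φ ψ {y} → y ∈ FVf (H u φ) ++ FVf (H u ψ) → y ∈ FVf φ ++ FVf ψ
  FV-H-++ u φ ψ y∈ with ∈-++⁻ (FVf (H u φ)) y∈
  ... | inj₁ p = ∈-++⁺ˡ (FV-H u φ p)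
  ... | inj₂ p = ∈-++⁺ʳ (FVf φ) (FV-H u ψ p)

  FV-H-relativized : ∀ u x φ {y} → y ∈ removeVar x (x ∷ x ∷ FVf (H u φ)) → y ∈ removeVar x (FVf φ)
  FV-H-relativized u x φ y∈ with ∈-removeVar⁻ x _ y∈
  ... | here y≡x , y≢x = ⊥-elim (y≢x y≡x)
  ... | there (here y≡x) , y≢x = ⊥-elim (y≢x y≡x)
  ... | there (there p) , y≢x = ∈-removeVar⁺ x (FVf φ) (FV-H u φ p) y≢x

∉-FV-D : ∀ u a {t y} → y ≢ t → y ∉ FVt a → y ∉ FVf (D u a t)
∉-FV-D u a y≢t y∉a y∈ = y∉a (FV-D-≢ u a y≢t y∈)

module _ (T : Theory) where
  mutual
    D-lang : ∀ u a t → LangF T (D u a t)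
    D-lang u (var x) t = var t ≐ var x
    D-lang u ∅t t = var t ≐ ∅t
    D-lang u ωt t = var t ≐ ωt
    D-lang u (pairt a b) t =
      ∃f _ (∃f _ (D-lang u a _ ∧f (D-lang u b _ ∧f (var t ≐ pairt (var _) (var _)))))
    D-lang u (⋃t a) t = ∃f _ (D-lang u a _ ∧f (var t ≐ ⋃t (var _)))
    D-lang u (𝒫t a) t =
      ∃f _ (D-lang u a _ ∧f ∀f _ ((var _ ∈f var t ⇒f Sub) ∧f (Sub ⇒f var _ ∈f var t)))
      where Sub = ∀f _ (var _ ∈f var _ ⇒f var _ ∈f var _)
    D-lang u (sept x a φ) t =
      ∃f _ (D-lang u a _ ∧f ∀f x ((var x ∈f var t ⇒f Body) ∧f (Body ⇒f var x ∈f var t)))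
      where Body = var x ∈f var _ ∧f H-lang u φ

    H-lang : ∀ u ψ → LangF T (H u ψ)
    H-lang u ⊥f = ⊥f
    H-lang u (a ≐ b) = ∃f u (D-lang u a u ∧f (D-lang u b u ∧f (var u ≐ var u)))
    H-lang u (a ∈f b) = ∃f u (∃f _ (D-lang u a u ∧f (D-lang u b _ ∧f (var u ∈f var _))))
    H-lang u (φ ∧f ψ) = H-lang u φ ∧f H-lang u ψ
    H-lang u (φ ∨f ψ) = H-lang u φ ∨f H-lang u ψ
    H-lang u (φ ⇒f ψ) = H-lang u φ ⇒f H-lang u ψ
    H-lang u (∀f x φ) = ∀f x ((var x ≐ var x) ⇒f H-lang u φ)
    H-lang u (∃f x φ) = ∃f x ((var x ≐ var x) ∧f H-lang u φ)

module Derivations (T : Theory) where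

  private
    variable
      Γ : List Formula
      A A′ B B′ C C′ P Q δ ε : Formula
      a b c s r : Term
      t v w x : Var

  L : Formula → Set
  L = LangF T

  LT : Term → Set
  LT = LangT T

  _⇔L_ : L A → L B → L (A ⇔f B)
  lA ⇔L lB = (lA ⇒f lB) ∧f (lB ⇒f lA)

  #0 : Prf T (A ∷ Γ) A
  #0 = hyp (here refl)

  #1 : Prf T (B ∷ A ∷ Γ) A
  #1 = hyp (there (here refl))

  #2 : Prf T (C ∷ B ∷ A ∷ Γ) A
  #2 = hyp (there (there (here refl)))

  #3 : Prf T (C′ ∷ C ∷ B ∷ A ∷ Γ) A
  #3 = hyp (there (there (there (here refl))))

  cut : L C → Prf T (C ∷ Γ) A → Prf T Γ C → Prf T Γ A
  cut lC p q = ⇒E (⇒I lC p) q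

  ⇔-refl : L A → Prf T Γ (A ⇔f A)
  ⇔-refl lA = ∧I (⇒I lA #0) (⇒I lA #0)

  ⇔-sym : Prf T Γ (A ⇔f B) → Prf T Γ (B ⇔f A)
  ⇔-sym p = ∧I (∧E₂ p) (∧E₁ p)

  -- Contexts cannot be weakened (∀I and ∃E carry eigenvariable conditions), so
  -- rules with premises are obtained by modus ponens from a tautology proved in
  -- the same context, or are stated for closed derivations only.
  ⇒-trans : L A → L B → L C → Prf T Γ (A ⇒f B) → Prf T Γ (B ⇒f C) → Prf T Γ (A ⇒f C)
  ⇒-trans lA lB lC p q = ⇒E (⇒E taut p) q
    where taut = ⇒I (lA ⇒f lB) (⇒I (lB ⇒f lC) (⇒I lA (⇒E #1 (⇒E #2 #0))))

  ⇔-trans : L A → L B → L C → Prf T Γ (A ⇔f B) → Prf T Γ (B ⇔f C) → Prf T Γ (A ⇔f C)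
  ⇔-trans lA lB lC p q =
    ∧I (⇒-trans lA lB lC (∧E₁ p) (∧E₁ q)) (⇒-trans lC lB lA (∧E₂ q) (∧E₂ p))

  ∧-cong : L A → L A′ → L B → L B′ →
           Prf T Γ (A ⇔f A′) → Prf T Γ (B ⇔f B′) → Prf T Γ ((A ∧f B) ⇔f (A′ ∧f B′))
  ∧-cong lA lA′ lB lB′ p q = ⇒E (⇒E taut p) q
    where
      taut = ⇒I (lA ⇔L lA′) (⇒I (lB ⇔L lB′)
        (∧I (⇒I (lA ∧f lB) (∧I (⇒E (∧E₁ #2) (∧E₁ #0)) (⇒E (∧E₁ #1) (∧E₂ #0))))
            (⇒I (lA′ ∧f lB′) (∧I (⇒E (∧E₂ #2) (∧E₁ #0)) (⇒E (∧E₂ #1) (∧E₂ #0))))))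

  ∨-cong : L A → L A′ → L B → L B′ →
           Prf T Γ (A ⇔f A′) → Prf T Γ (B ⇔f B′) → Prf T Γ ((A ∨f B) ⇔f (A′ ∨f B′))
  ∨-cong lA lA′ lB lB′ p q = ⇒E (⇒E taut p) q
    where
      taut = ⇒I (lA ⇔L lA′) (⇒I (lB ⇔L lB′)
        (∧I (⇒I (lA ∨f lB) (∨E #0 (∨I₁ lB′ (⇒E (∧E₁ #3) #0))
                                   (∨I₂ lA′ (⇒E (∧E₁ #2) #0))))
            (⇒I (lA′ ∨f lB′) (∨E #0 (∨I₁ lB (⇒E (∧E₂ #3) #0))
                                     (∨I₂ lA (⇒E (∧E₂ #2) #0))))))

  ⇒-cong : L A → L A′ → L B → L B′ →
           Prf T Γ (A ⇔f A′) → Prf T Γ (B ⇔f B′) → Prf T Γ ((A ⇒f B) ⇔f (A′ ⇒f B′))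
  ⇒-cong lA lA′ lB lB′ p q = ⇒E (⇒E taut p) q
    where
      taut = ⇒I (lA ⇔L lA′) (⇒I (lB ⇔L lB′)
        (∧I (⇒I (lA ⇒f lB) (⇒I lA′ (⇒E (∧E₁ #2) (⇒E #1 (⇒E (∧E₂ #3) #0)))))
            (⇒I (lA′ ⇒f lB′) (⇒I lA (⇒E (∧E₂ #2) (⇒E #1 (⇒E (∧E₁ #3) #0)))))))

  ⇔-cong : L A → L A′ → L B → L B′ →
           Prf T Γ (A ⇔f A′) → Prf T Γ (B ⇔f B′) → Prf T Γ ((A ⇔f B) ⇔f (A′ ⇔f B′))
  ⇔-cong lA lA′ lB lB′ p q =
    ∧-cong (lA ⇒f lB) (lA′ ⇒f lB′) (lB ⇒f lA) (lB′ ⇒f lA′)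
           (⇒-cong lA lA′ lB lB′ p q) (⇒-cong lB lB′ lA lA′ q p)

  ∧-identityˡ : L A → L B → (∀ {Δ} → Prf T Δ B) → Prf T Γ (A ⇔f (B ∧f A))
  ∧-identityˡ lA lB ⊢B = ∧I (⇒I lA (∧I ⊢B #0)) (⇒I (lB ∧f lA) (∧E₂ #0))

  ∧-identityʳ : L A → L B → (∀ {Δ} → Prf T Δ B) → Prf T Γ (A ⇔f (A ∧f B))
  ∧-identityʳ lA lB ⊢B = ∧I (⇒I lA (∧I #0 ⊢B)) (⇒I (lA ∧f lB) (∧E₁ #0))

  ⇒-identityˡ : L A → L B → (∀ {Δ} → Prf T Δ B) → Prf T Γ (A ⇔f (B ⇒f A))
  ⇒-identityˡ lA lB ⊢B = ∧I (⇒I lA (⇒I lB #1)) (⇒I (lB ⇒f lA) (⇒E #0 ⊢B))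

  ∉-FVs : All (λ ψ → x ∉ FVf ψ) Γ → x ∉ FVs Γ
  ∉-FVs (x∉φ ∷ x∉Γ) x∈ = ∉-++⁺ x∉φ (∉-FVs x∉Γ) x∈

  ∉FV-bound : ∀ x A → x ∉ FVf (∀f x A)
  ∉FV-bound x A = ∉-removeVar x (FVf A)

  ∀I-fresh : All (λ ψ → x ∉ FVf ψ) Γ → Prf T Γ A → Prf T Γ (∀f x A)
  ∀I-fresh x∉Γ = ∀I (∉-FVs x∉Γ)

  ∃E-fresh : Prf T Γ (∃f x A) → All (λ ψ → x ∉ FVf ψ) Γ → x ∉ FVf C →
             Prf T (A ∷ Γ) C → Prf T Γ C
  ∃E-fresh p x∉Γ = ∃E p (∉-FVs x∉Γ)

  ∀E-self : Prf T Γ (∀f x A) → Prf T Γ A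
  ∀E-self {Γ} {x} {A} p = subst (Prf T Γ) (substF-id x A) (∀E (var x) (var x) (FreeForF-self x A) p)

  ∃I-self : L (∃f x A) → Prf T Γ A → Prf T Γ (∃f x A)
  ∃I-self {x} {A} {Γ} l p =
    ∃I (var x) l (var x) (FreeForF-self x A) (subst (Prf T Γ) (sym (substF-id x A)) p)

  ∀-cong : L A → L B → T ⊢ (A ⇔f B) → T ⊢ (∀f x A ⇔f ∀f x B)
  ∀-cong {A} {B} {x} lA lB A⇔B = cut (∀f x (lA ⇔L lB)) both (∀I (λ ()) A⇔B)
    where
      both : Prf T (∀f x (A ⇔f B) ∷ []) (∀f x A ⇔f ∀f x B)
      both = ∧I
        (⇒I (∀f x lA) (∀I-fresh (∉FV-bound x A ∷ ∉FV-bound x (A ⇔f B) ∷ [])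
          (⇒E (∧E₁ (∀E-self #1)) (∀E-self #0))))
        (⇒I (∀f x lB) (∀I-fresh (∉FV-bound x B ∷ ∉FV-bound x (A ⇔f B) ∷ [])
          (⇒E (∧E₂ (∀E-self #1)) (∀E-self #0))))

  ∃-cong : L A → L B → T ⊢ (A ⇔f B) → T ⊢ (∃f x A ⇔f ∃f x B)
  ∃-cong {A} {B} {x} lA lB A⇔B = cut (∀f x (lA ⇔L lB)) both (∀I (λ ()) A⇔B)
    where
      both : Prf T (∀f x (A ⇔f B) ∷ []) (∃f x A ⇔f ∃f x B)
      both = ∧I
        (⇒I (∃f x lA)
          (∃E-fresh #0 (∉FV-bound x A ∷ ∉FV-bound x (A ⇔f B) ∷ []) (∉FV-bound x B)
            (∃I-self (∃f x lB) (⇒E (∧E₁ (∀E-self #2)) #0))))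
        (⇒I (∃f x lB)
          (∃E-fresh #0 (∉FV-bound x B ∷ ∉FV-bound x (A ⇔f B) ∷ []) (∉FV-bound x A)
            (∃I-self (∃f x lA) (⇒E (∧E₂ (∀E-self #2)) #0))))

  ∃-distribˡ-∧ : L A → L B → x ∉ FVf A → T ⊢ (∃f x (A ∧f B) ⇔f (A ∧f ∃f x B))
  ∃-distribˡ-∧ {A} {B} {x} lA lB x∉A = ∧I
    (⇒I (∃f x (lA ∧f lB))
      (∃E-fresh #0 (∉FV-bound x (A ∧f B) ∷ []) (∉-++⁺ x∉A (∉FV-bound x B))
        (∧I (∧E₁ #0) (∃I-self (∃f x lB) (∧E₂ #0)))))
    (⇒I (lA ∧f ∃f x lB)
      (∃E-fresh (∧E₂ #0) (∉-++⁺ x∉A (∉FV-bound x B) ∷ []) (∉FV-bound x (A ∧f B))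
        (∃I-self (∃f x (lA ∧f lB)) (∧I (∧E₁ #1) #0))))

  leibniz-≡ : L P → FreeForF s x P → FreeForF r x P → substF x s P ≡ A → substF x r P ≡ B →
              Prf T Γ (s ≐ r) → Prf T Γ A → Prf T Γ B
  leibniz-≡ lP fs fr refl refl = leibniz lP fs fr

  ≐-sym : LT s → Prf T Γ (s ≐ r) → Prf T Γ (r ≐ s)
  ≐-sym {s} {r = r} ls s≐r =
    leibniz-≡ (var q ≐ ls) (tt , freeFor s) (tt , freeFor r)
      (cong₂ _≐_ (substT-var-self q s) (substT-absent q s s q∉s))
      (cong₂ _≐_ (substT-var-self q r) (substT-absent q r s q∉s))
      s≐r (refl≐ ls)
    where
      q = fresh (varsT s)
      q∉s = fresh-∉ (varsT s)
      freeFor : ∀ t → FreeForT t q s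
      freeFor t = FreeForT-notFree t q s (∉varsT⇒∉FVt s q∉s)

  ≐-trans : LT s → Prf T Γ (s ≐ r) → Prf T Γ (r ≐ c) → Prf T Γ (s ≐ c)
  ≐-trans {s} {r = r} {c = c} ls s≐r r≐c =
    leibniz-≡ (ls ≐ var q) (freeFor r , tt) (freeFor c , tt)
      (cong₂ _≐_ (substT-absent q r s q∉s) (substT-var-self q r))
      (cong₂ _≐_ (substT-absent q c s q∉s) (substT-var-self q c))
      r≐c s≐r
    where
      q = fresh (varsT s)
      q∉s = fresh-∉ (varsT s)
      freeFor : ∀ t → FreeForT t q s
      freeFor t = FreeForT-notFree t q s (∉varsT⇒∉FVt s q∉s)

  rewrite-var : L P → FreeForF a v P → substF v a P ≡ B →
                Prf T Γ (var v ≐ a) → Prf T Γ P → Prf T Γ B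
  rewrite-var {P} {v = v} lP ff eq =
    leibniz-≡ lP (FreeForF-self v P) ff (substF-id v P) eq

  rewrite-var⁻ : L P → FreeForF a v P → substF v a P ≡ B →
                 Prf T Γ (var v ≐ a) → Prf T Γ B → Prf T Γ P
  rewrite-var⁻ {P} {v = v} lP ff eq v≐a =
    leibniz-≡ lP ff (FreeForF-self v P) eq (substF-id v P) (≐-sym (var v) v≐a)

  ∃-≐ : LT a → v ∉ varsT a → Prf T Γ (∃f v (var v ≐ a))
  ∃-≐ {a} {v} {Γ} la v∉a =
    ∃I a (∃f v (var v ≐ la)) la (tt , FreeForT-notFree a v a (∉varsT⇒∉FVt a v∉a))
       (subst (Prf T Γ) (sym (cong₂ _≐_ (substT-var-self v a) (substT-absent v a a v∉a))) (refl≐ la))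

  members-transport : L P → w ∉ FVt s → w ∉ FVt r → Prf T Γ (s ≐ r) →
                      Prf T Γ (∀f w (var w ∈f s ⇔f P)) → Prf T Γ (∀f w (var w ∈f r ⇔f P))
  members-transport {P} {w} {s} {r} lP w∉s w∉r =
    leibniz-≡ (∀f w ((var w ∈f var q) ⇔L lP))
      (freeFor s w∉s) (freeFor r w∉r) (instance≡ s) (instance≡ r)
    where
      q = fresh (w ∷ varsF P)
      q≢w : q ≢ w
      q≢w q≡w = fresh-∉ (w ∷ varsF P) (here q≡w)
      q∉P : q ∉ varsF P
      q∉P q∈ = fresh-∉ (w ∷ varsF P) (there q∈)
      freeFor : ∀ c → w ∉ FVt c → FreeForF c q (∀f w (var w ∈f var q ⇔f P))
      freeFor c w∉c _ = w∉c , ((tt , tt) , ffP) , (ffP , (tt , tt))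
        where ffP = FreeForF-notFree c q P (∉varsF⇒∉FVf P q∉P)
      instance≡ : ∀ c → substF q c (∀f w (var w ∈f var q ⇔f P)) ≡ ∀f w (var w ∈f c ⇔f P)
      instance≡ c rewrite substF-∀ c (var w ∈f var q ⇔f P) q≢w
                        | substT-var-other c q≢w | substT-var-self q c | substF-absent q c P q∉P = refl

  ≐-extensional : LT c → L P → w ≢ t → w ∉ FVt c →
                  T ⊢ ∀f w (var w ∈f c ⇔f P) → T ⊢ (var t ≐ c ⇔f ∀f w (var w ∈f var t ⇔f P))
  ≐-extensional {c} {P} {w} {t} lc lP w≢t w∉c ⊢members =
    cut (∀f w ((var w ∈f lc) ⇔L lP)) (∧I ⇒-direction ⇐-direction) ⊢members
    where
      Xs = w ∷ t ∷ varsT c ++ varsF P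
      z = fresh Xs
      z≢w : z ≢ w
      z≢w z≡w = fresh-∉ Xs (here z≡w)
      z≢t : z ≢ t
      z≢t z≡t = fresh-∉ Xs (there (here z≡t))
      z∉c : z ∉ FVt c
      z∉c z∈ = fresh-∉ Xs (there (there (∈-++⁺ˡ (FVt⊆varsT c z∈))))
      z∉P : z ∉ FVf P
      z∉P z∈ = fresh-∉ Xs (there (there (∈-++⁺ʳ (varsT c) (FVf⊆varsF P z∈))))
      w∉t : w ∉ FVt (var t)
      w∉t (here w≡t) = w≢t w≡t
      members-of : ∀ s → z ∉ FVt s → z ∉ FVf (∀f w (var w ∈f s ⇔f P))
      members-of s z∉s = ∉-removeVar⁺ w (FVf (var w ∈f s ⇔f P)) (∉-FV-⇔ (var w ∈f s) P
        (λ { (here z≡w) → z≢w z≡w ; (there z∈s) → z∉s z∈s }) z∉P)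
      M = ∀f w (var w ∈f c ⇔f P)
      N = ∀f w (var w ∈f var t ⇔f P)
      ⇒-direction : Prf T (M ∷ []) (var t ≐ c ⇒f N)
      ⇒-direction = ⇒I (var t ≐ lc) (members-transport lP w∉c w∉t (≐-sym (var t) #0) #1)
      -- Extensionality is an axiom about variables only, hence the name z for c.
      extensional : Prf T (var z ≐ c ∷ N ∷ M ∷ []) (var t ≐ var z)
      extensional =
        ⇒E (axiom (extensionality ((λ { (here w≡t) → w≢t w≡t ; (there (here w≡z)) → z≢w (sym w≡z) })
                                  , (λ { (here t≡z) → z≢t (sym t≡z) }) , (λ ()) , tt)))
           (∀I-fresh ((λ { (here w≡z) → z≢w (sym w≡z) ; (there w∈c) → w∉c w∈c })
                      ∷ ∉FV-bound w (var w ∈f var t ⇔f P)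
                      ∷ ∉FV-bound w (var w ∈f c ⇔f P) ∷ [])
             (⇔-trans (var w ∈f var t) lP (var w ∈f var z) (∀E-self #1)
               (⇔-sym (∀E-self (members-transport lP w∉c (λ { (here w≡z) → z≢w (sym w≡z) })
                                                  (≐-sym (var z) #0) #2)))))
      ⇐-direction : Prf T (M ∷ []) (N ⇒f var t ≐ c)
      ⇐-direction = ⇒I (∀f w ((var w ∈f var t) ⇔L lP))
        (∃E-fresh (∃-≐ lc (λ z∈ → fresh-∉ Xs (there (there (∈-++⁺ˡ z∈)))))
          (members-of (var t) (λ { (here z≡t) → z≢t z≡t }) ∷ members-of c z∉c ∷ [])
          (λ { (here z≡t) → z≢t z≡t ; (there z∈c) → z∉c z∈c })
          (≐-trans (var t) extensional #0))

  one-point : LT a → L δ → L P → L B → v ∉ varsT a → v ∉ FVf B →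
              FreeForF a v P → substF v a P ≡ B →
              T ⊢ ∀f v (var v ≐ a ⇔f δ) → T ⊢ (B ⇔f ∃f v (δ ∧f P))
  one-point {a} {δ} {P} {B} {v} la lδ lP lB v∉a v∉B ff eq ⊢def =
    cut (∀f v ((var v ≐ la) ⇔L lδ)) (∧I ⇒-direction ⇐-direction) ⊢def
    where
      v∉Def = ∉FV-bound v (var v ≐ a ⇔f δ)
      v∉∃ = ∉FV-bound v (δ ∧f P)
      ⇒-direction : Prf T (∀f v (var v ≐ a ⇔f δ) ∷ []) (B ⇒f ∃f v (δ ∧f P))
      ⇒-direction = ⇒I lB (∃E-fresh (∃-≐ la v∉a) (v∉B ∷ v∉Def ∷ []) v∉∃
        (∃I-self (∃f v (lδ ∧f lP)) (∧I (⇒E (∧E₁ (∀E-self #2)) #0) (rewrite-var⁻ lP ff eq #0 #1))))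
      ⇐-direction : Prf T (∀f v (var v ≐ a ⇔f δ) ∷ []) (∃f v (δ ∧f P) ⇒f B)
      ⇐-direction = ⇒I (∃f v (lδ ∧f lP)) (∃E-fresh #0 (v∉∃ ∷ v∉Def ∷ []) v∉B
        (rewrite-var lP ff eq (⇒E (∧E₂ (∀E-self #2)) (∧E₁ #0)) (∧E₂ #0)))

  ∃∧-congʳ : L δ → L A → L A′ → T ⊢ (A ⇔f A′) → T ⊢ (∃f v (δ ∧f A) ⇔f ∃f v (δ ∧f A′))
  ∃∧-congʳ lδ lA lA′ A⇔A′ =
    ∃-cong (lδ ∧f lA) (lδ ∧f lA′) (∧-cong lδ lδ lA lA′ (⇔-refl lδ) A⇔A′)

  ∃∧-nest : L δ → L ε → L P → L Q → w ∉ FVf δ → T ⊢ (Q ⇔f ∃f w (ε ∧f P)) →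
            T ⊢ (∃f v (δ ∧f Q) ⇔f ∃f v (∃f w (δ ∧f ε ∧f P)))
  ∃∧-nest lδ lε lP lQ w∉δ Q⇔∃ =
    ⇔-trans (∃f _ (lδ ∧f lQ)) (∃f _ (lδ ∧f ∃f _ (lε ∧f lP))) (∃f _ (∃f _ (lδ ∧f lε ∧f lP)))
      (∃∧-congʳ lδ lQ (∃f _ (lε ∧f lP)) Q⇔∃)
      (∃-cong (lδ ∧f ∃f _ (lε ∧f lP)) (∃f _ (lδ ∧f lε ∧f lP))
        (⇔-sym (∃-distribˡ-∧ lδ (lε ∧f lP) w∉δ)))

  ≐-𝒫-members : ∀ {z} → Impredicative T → Distinct (z ∷ w ∷ v ∷ []) → w ≢ t →
                T ⊢ (var t ≐ 𝒫t (var v) ⇔f ∀f w (var w ∈f var t ⇔f subsetF z (var w) (var v)))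
  ≐-𝒫-members {w} {v} {z = z} imp distinct@(_ , w∉v , _) w≢t =
    ≐-extensional (𝒫t imp (var v)) (∀f z (var z ∈f var w ⇒f var z ∈f var v)) w≢t w∉v
      (∀I (λ ()) (axiom (powerAx imp distinct)))

  ≐-sept-members : ∀ {φ} → LT (sept x (var v) φ) → x ≢ t → x ≢ v →
                   T ⊢ (var t ≐ sept x (var v) φ ⇔f ∀f x (var x ∈f var t ⇔f (var x ∈f var v ∧f φ)))
  ≐-sept-members {x} {v} {φ = φ} lS@(sept _ _ lφ _) x≢t x≢v =
    ≐-extensional lS (var x ∈f var v ∧f lφ) x≢t
      (∉-++⁺ (λ { (here x≡v) → x≢v x≡v }) (∉FV-bound x φ))
      (∀I (λ ()) (subst (λ ψ → T ⊢ (var x ∈f sept x (var v) φ ⇔f (var x ∈f var v ∧f ψ)))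
                        (substF-id x φ) (axiom (sepAx lS (FreeForF-self x φ)))))

module Translation (T : Theory) (u : Var) where

  open Derivations T

  mutual
    defines : ∀ a → LT a → u ∉ varsT a → ∀ v → v ∉ varsT a → T ⊢ ∀f v (var v ≐ a ⇔f D u a v)
    defines a la u∉a v v∉a = ∀I (λ ()) (D-correct a la u∉a v v∉a)

    D-correct : ∀ a → LT a → u ∉ varsT a → ∀ t → t ∉ varsT a → T ⊢ (var t ≐ a ⇔f D u a t)
    D-correct (var x) _ _ t _ = ⇔-refl (var t ≐ var x)
    D-correct ∅t _ _ t _ = ⇔-refl (var t ≐ ∅t)
    D-correct ωt _ _ t _ = ⇔-refl (var t ≐ ωt)
    D-correct (⋃t a) (⋃t la) u∉a t t∉a =
      one-point la (D-lang T u a v) (var t ≐ ⋃t (var v)) (var t ≐ ⋃t la) v∉a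
        (λ { (here v≡t) → v≢t v≡t ; (there v∈a) → v∉a (FVt⊆varsT a v∈a) })
        (tt , tt) (cong₂ _≐_ (substT-var-other a v≢t) (cong ⋃t (substT-var-self v a)))
        (defines a la u∉a v v∉a)
      where
        Xs = u ∷ t ∷ varsT a
        v = fresh Xs
        v∉a : v ∉ varsT a
        v∉a v∈ = fresh-∉ Xs (there (there v∈))
        v≢t : v ≢ t
        v≢t v≡t = fresh-∉ Xs (there (here v≡t))
    D-correct (pairt a b) (pairt la lb) u∉ab t t∉ab =
      ⇔-trans (var t ≐ pairt la lb) (∃f v (lDa ∧f lQ)) (D-lang T u (pairt a b) t)
        (one-point la lDa lQ (var t ≐ pairt la lb) v∉a
           (λ { (here v≡t) → v≢t v≡t
              ; (there v∈ab) → fresh-∉ Xs (there (there (FVt⊆varsT (pairt a b) v∈ab))) })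
           (tt , tt , FreeForT-notFree a v b (∉varsT⇒∉FVt b v∉b))
           (cong₂ _≐_ (substT-var-other a v≢t)
                      (cong₂ pairt (substT-var-self v a) (substT-absent v a b v∉b)))
           (defines a la u∉a v v∉a))
        (∃∧-nest lDa lDb (var t ≐ pairt (var v) (var w)) lQ
           (∉-FV-D u a w≢v (∉varsT⇒∉FVt a w∉a))
           (one-point lb lDb (var t ≐ pairt (var v) (var w)) lQ w∉b
              (λ { (here w≡t) → w≢t w≡t ; (there (here w≡v)) → w≢v w≡v
                 ; (there (there w∈b)) → w∉b (FVt⊆varsT b w∈b) })
              (tt , tt , tt)
              (cong₂ _≐_ (substT-var-other b w≢t)
                         (cong₂ pairt (substT-var-other b w≢v) (substT-var-self w b)))
              (defines b lb u∉b w w∉b)))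
      where
        Xs = u ∷ t ∷ varsT a ++ varsT b
        v = fresh Xs
        w = suc v
        u∉a = ∉-++⁻ˡ (varsT b) u∉ab
        u∉b = ∉-++⁻ʳ (varsT a) u∉ab
        v∉a = ∉-++⁻ˡ (varsT b) (λ v∈ → fresh-∉ Xs (there (there v∈)))
        v∉b = ∉-++⁻ʳ (varsT a) (λ v∈ → fresh-∉ Xs (there (there v∈)))
        w∉a = ∉-++⁻ˡ (varsT b) (λ w∈ → fresh+1-∉ Xs (there (there w∈)))
        w∉b = ∉-++⁻ʳ (varsT a) (λ w∈ → fresh+1-∉ Xs (there (there w∈)))
        v≢t : v ≢ t
        v≢t v≡t = fresh-∉ Xs (there (here v≡t))
        w≢t : w ≢ t
        w≢t w≡t = fresh+1-∉ Xs (there (here w≡t))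
        w≢v : w ≢ v
        w≢v = 1+n≢n
        lDa = D-lang T u a v
        lDb = D-lang T u b w
        lQ : L (var t ≐ pairt (var v) b)
        lQ = var t ≐ pairt (var v) lb
    D-correct (𝒫t a) (𝒫t imp la) u∉a t t∉a =
      ⇔-trans (var t ≐ 𝒫t imp la) (∃f v (lDa ∧f lP)) (D-lang T u (𝒫t a) t)
        (one-point la lDa lP (var t ≐ 𝒫t imp la) v∉a
           (λ { (here v≡t) → v≢t v≡t ; (there v∈a) → v∉a (FVt⊆varsT a v∈a) })
           (tt , tt) (cong₂ _≐_ (substT-var-other a v≢t) (cong 𝒫t (substT-var-self v a)))
           (defines a la u∉a v v∉a))
        (∃∧-congʳ lDa lP (∀f w ((var w ∈f var t) ⇔L ∀f z (var z ∈f var w ⇒f var z ∈f var v)))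
           (≐-𝒫-members imp ((λ { (here z≡w) → 1+n≢n z≡w ; (there (here z≡v)) → m+1+n≢n 1 z≡v })
                             , (λ { (here w≡v) → 1+n≢n w≡v }) , (λ ()) , tt) w≢t))
      where
        Xs = u ∷ t ∷ varsT a
        v = fresh Xs
        w = suc v
        z = suc w
        v∉a : v ∉ varsT a
        v∉a v∈ = fresh-∉ Xs (there (there v∈))
        v≢t : v ≢ t
        v≢t v≡t = fresh-∉ Xs (there (here v≡t))
        w≢t : w ≢ t
        w≢t w≡t = fresh+1-∉ Xs (there (here w≡t))
        lDa = D-lang T u a v
        lP : L (var t ≐ 𝒫t (var v))
        lP = var t ≐ 𝒫t imp (var v)
    D-correct (sept x a φ) (sept x∉a la lφ sep) u∉ t t∉ =
      ⇔-trans (var t ≐ sept x∉a la lφ sep) (∃f v (lDa ∧f (var t ≐ lSv)))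
              (D-lang T u (sept x a φ) t)
        (one-point la lDa (var t ≐ lSv) (var t ≐ sept x∉a la lφ sep) v∉a
           (λ { (here v≡t) → v≢t v≡t
              ; (there v∈S) → fresh-∉ Xs (there (there (FVt⊆varsT (sept x a φ) v∈S))) })
           (tt , tt , λ v∈φ → ⊥-elim (v∉φ (FVf⊆varsF φ (proj₁ (∈-removeVar⁻ x (FVf φ) v∈φ)))))
           (cong₂ _≐_ (substT-var-other a v≢t)
                      (trans (substT-sept a (var v) φ v≢x v∉φ)
                             (cong (λ c → sept x c φ) (substT-var-self v a))))
           (defines a la u∉a v v∉a))
        (∃∧-congʳ lDa (var t ≐ lSv) (∀f x ((var x ∈f var t) ⇔L lBodyH)) members)
      where
        Xs = u ∷ t ∷ x ∷ varsT a ++ varsF φ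
        v = fresh Xs
        u∉a = ∉-++⁻ˡ (varsF φ) (λ u∈ → u∉ (there u∈))
        u∉φ = ∉-++⁻ʳ (varsT a) (λ u∈ → u∉ (there u∈))
        v∉a = ∉-++⁻ˡ (varsF φ) (λ v∈ → fresh-∉ Xs (there (there (there v∈))))
        v∉φ = ∉-++⁻ʳ (varsT a) (λ v∈ → fresh-∉ Xs (there (there (there v∈))))
        v≢t : v ≢ t
        v≢t v≡t = fresh-∉ Xs (there (here v≡t))
        v≢x : v ≢ x
        v≢x v≡x = fresh-∉ Xs (there (there (here v≡x)))
        x≢t : x ≢ t
        x≢t x≡t = t∉ (here (sym x≡t))
        lDa = D-lang T u a v
        lHφ = H-lang T u φ
        lSv : LT (sept x (var v) φ)
        lSv = sept (λ { (here x≡v) → v≢x (sym x≡v) }) (var v) lφ sep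
        lBody = var x ∈f var v ∧f lφ
        lBodyH = var x ∈f var v ∧f lHφ
        members : T ⊢ (var t ≐ sept x (var v) φ ⇔f
                       ∀f x (var x ∈f var t ⇔f (var x ∈f var v ∧f H u φ)))
        members =
          ⇔-trans (var t ≐ lSv) (∀f x ((var x ∈f var t) ⇔L lBody)) (∀f x ((var x ∈f var t) ⇔L lBodyH))
            (≐-sept-members lSv x≢t (λ x≡v → v≢x (sym x≡v)))
            (∀-cong ((var x ∈f var t) ⇔L lBody) ((var x ∈f var t) ⇔L lBodyH)
              (⇔-cong (var x ∈f var t) (var x ∈f var t) lBody lBodyH (⇔-refl (var x ∈f var t))
                (∧-cong (var x ∈f var v) (var x ∈f var v) lφ lHφ
                  (⇔-refl (var x ∈f var v)) (H-correct φ lφ u∉φ))))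

    H-correct : ∀ ψ → L ψ → u ∉ varsF ψ → T ⊢ (ψ ⇔f H u ψ)
    H-correct ⊥f ⊥f _ = ⇔-refl ⊥f
    H-correct (a ≐ b) (la ≐ lb) u∉ab =
      ⇔-trans (la ≐ lb) (∃f u (lDa ∧f lP)) (H-lang T u (a ≐ b))
        (⇔-trans (la ≐ lb) ((la ≐ lb) ∧f (la ≐ la)) (∃f u (lDa ∧f lP))
          (∧-identityʳ (la ≐ lb) (la ≐ la) (refl≐ la))
          (one-point la lDa lP ((la ≐ lb) ∧f (la ≐ la)) u∉a
             (∉-++⁺ (∉varsF⇒∉FVf (a ≐ b) u∉ab) (∉-++⁺ (∉varsT⇒∉FVt a u∉a) (∉varsT⇒∉FVt a u∉a)))
             ((tt , FreeForT-notFree a u b (∉varsT⇒∉FVt b u∉b)) , tt , tt)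
             (cong₂ _∧f_ (cong₂ _≐_ (substT-var-self u a) (substT-absent u a b u∉b))
                         (cong₂ _≐_ (substT-var-self u a) (substT-var-self u a)))
             (defines a la u∉a u u∉a)))
        (∃∧-congʳ lDa lP (D-lang T u b u ∧f (var u ≐ var u))
          (∧-cong (var u ≐ lb) (D-lang T u b u) (var u ≐ var u) (var u ≐ var u)
            (D-correct b lb u∉b u u∉b) (⇔-refl (var u ≐ var u))))
      where
        u∉a = ∉-++⁻ˡ (varsT b) u∉ab
        u∉b = ∉-++⁻ʳ (varsT a) u∉ab
        lDa = D-lang T u a u
        lP : L (var u ≐ b ∧f var u ≐ var u)
        lP = (var u ≐ lb) ∧f (var u ≐ var u)
    H-correct (a ∈f b) (la ∈f lb) u∉ab =
      ⇔-trans (la ∈f lb) (∃f u (lDa ∧f lQ)) (H-lang T u (a ∈f b))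
        (one-point la lDa lQ (la ∈f lb) u∉a (∉varsF⇒∉FVf (a ∈f b) u∉ab)
           (tt , FreeForT-notFree a u b (∉varsT⇒∉FVt b u∉b))
           (cong₂ _∈f_ (substT-var-self u a) (substT-absent u a b u∉b))
           (defines a la u∉a u u∉a))
        (∃∧-nest lDa lDb (var u ∈f var v) lQ (∉-FV-D u a v≢u (∉varsT⇒∉FVt a v∉a))
           (one-point lb lDb (var u ∈f var v) lQ v∉b
              (λ { (here v≡u) → v≢u v≡u ; (there v∈b) → v∉b (FVt⊆varsT b v∈b) })
              (tt , tt) (cong₂ _∈f_ (substT-var-other b v≢u) (substT-var-self v b))
              (defines b lb u∉b v v∉b)))
      where
        Xs = u ∷ varsT a ++ varsT b
        v = fresh Xs
        u∉a = ∉-++⁻ˡ (varsT b) u∉ab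
        u∉b = ∉-++⁻ʳ (varsT a) u∉ab
        v∉a = ∉-++⁻ˡ (varsT b) (λ v∈ → fresh-∉ Xs (there v∈))
        v∉b = ∉-++⁻ʳ (varsT a) (λ v∈ → fresh-∉ Xs (there v∈))
        v≢u : v ≢ u
        v≢u v≡u = fresh-∉ Xs (here v≡u)
        lDa = D-lang T u a u
        lDb = D-lang T u b v
        lQ : L (var u ∈f b)
        lQ = var u ∈f lb
    H-correct (φ ∧f ψ) (lφ ∧f lψ) u∉ =
      ∧-cong lφ (H-lang T u φ) lψ (H-lang T u ψ)
        (H-correct φ lφ (∉-++⁻ˡ (varsF ψ) u∉)) (H-correct ψ lψ (∉-++⁻ʳ (varsF φ) u∉))
    H-correct (φ ∨f ψ) (lφ ∨f lψ) u∉ =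
      ∨-cong lφ (H-lang T u φ) lψ (H-lang T u ψ)
        (H-correct φ lφ (∉-++⁻ˡ (varsF ψ) u∉)) (H-correct ψ lψ (∉-++⁻ʳ (varsF φ) u∉))
    H-correct (φ ⇒f ψ) (lφ ⇒f lψ) u∉ =
      ⇒-cong lφ (H-lang T u φ) lψ (H-lang T u ψ)
        (H-correct φ lφ (∉-++⁻ˡ (varsF ψ) u∉)) (H-correct ψ lψ (∉-++⁻ʳ (varsF φ) u∉))
    H-correct (∀f x φ) (∀f .x lφ) u∉ =
      ∀-cong lφ ((var x ≐ var x) ⇒f H-lang T u φ)
        (⇔-trans lφ (H-lang T u φ) ((var x ≐ var x) ⇒f H-lang T u φ)
          (H-correct φ lφ (λ u∈ → u∉ (there u∈)))
          (⇒-identityˡ (H-lang T u φ) (var x ≐ var x) (refl≐ (var x))))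
    H-correct (∃f x φ) (∃f .x lφ) u∉ =
      ∃-cong lφ ((var x ≐ var x) ∧f H-lang T u φ)
        (⇔-trans lφ (H-lang T u φ) ((var x ≐ var x) ∧f H-lang T u φ)
          (H-correct φ lφ (λ u∈ → u∉ (there u∈)))
          (∧-identityˡ (H-lang T u φ) (var x ≐ var x) (refl≐ (var x))))

proposition1 : (T : Theory) (u : Var) →
    ((a : Term) → LangT T a → CleanT a → u ∉ varsT a →
       T ⊢ (var u ≐ a ⇔f D u a u))
    × ((ψ : Formula) → LangF T ψ → CleanF ψ → u ∉ varsF ψ →
       T ⊢ (ψ ⇔f H u ψ))
proposition1 T u =
    (λ a la _ u∉a → D-correct a la u∉a u u∉a)
  , (λ ψ lψ _ u∉ψ → H-correct ψ lψ u∉ψ)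
  where open Translation T u
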